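{- Every finite group of odd order is code-perfect.
   Context: For a group $G$ and an inverse-closed subset $S\subseteq G$ with $e\notin S$, the Cayley graph $\mathrm{Cay}(G,S)$ has vertex set $G$, with distinct $x,y$ adjacent iff $yx^{ -1}\in S$. A subset $C$ of the vertex set of a graph is a perfect code if it is independent and every vertex outside $C$ is adjacent to exactly one vertex of $C$. A subset $C$ of $G$ is a perfect code of $G$ if some Cayley graph $\mathrm{Cay}(G,S)$ admits $C$ as a perfect code. A group $G$ is code-perfect if every proper subgroup of $G$ is a perfect code of $G$. -}

module Defs where

open import Data.Nat using (ℕ)
open import Data.Nat.Divisibility using (_∣_)
open import Data.Fin using (Fin)
open import Data.Fin.Subset using (Subset; _∈_; _∉_)
open import Data.Product using (Σ; _×_; ∃; ∃-syntax)
open import Relation.Binary.PropositionalEquality using (_≡_; _≢_)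
open import Relation.Nullary using (¬_)
open import Algebra.Structures using (IsGroup)

-- A finite group of order n, presented with carrier Fin n
-- (every finite group of order n is isomorphic to such a group).
record FiniteGroup (n : ℕ) : Set where
  infixl 7 _∙_
  field
    _∙_     : Fin n → Fin n → Fin n
    ε       : Fin n
    _⁻¹     : Fin n → Fin n
    isGroup : IsGroup _≡_ _∙_ ε _⁻¹

module _ {n : ℕ} (G : FiniteGroup n) where
  open FiniteGroup G

  InverseClosed : Subset n → Set
  InverseClosed S = ∀ g → g ∈ S → (g ⁻¹) ∈ S

  Adj : Subset n → Fin n → Fin n → Set
  Adj S x y = x ≢ y × (y ∙ (x ⁻¹)) ∈ S

  IsPerfectCodeIn : Subset n → Subset n → Set
  IsPerfectCodeIn S C =
    (∀ x y → x ∈ C → y ∈ C → ¬ Adj S x y)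
    × (∀ x → x ∉ C →
         Σ (Fin n) λ c → c ∈ C × Adj S x c
           × (∀ c′ → c′ ∈ C → Adj S x c′ → c′ ≡ c))

  IsPerfectCodeOf : Subset n → Set
  IsPerfectCodeOf C =
    ∃[ S ] (InverseClosed S × ε ∉ S × IsPerfectCodeIn S C)

  IsSubgroup : Subset n → Set
  IsSubgroup H =
    ε ∈ H × (∀ x y → x ∈ H → y ∈ H → (x ∙ y) ∈ H)
          × (∀ x → x ∈ H → (x ⁻¹) ∈ H)

  IsProper : Subset n → Set
  IsProper H = ∃[ g ] g ∉ H

  CodePerfect : Set
  CodePerfect = ∀ H → IsSubgroup H → IsProper H → IsPerfectCodeOf H

-- A subgroup H is a perfect code as soon as it has an inverse-closed right transversal T
-- containing ε: take S = T ∖ {ε}. Such a T is built greedily. Call z uncovered if no element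
-- of T lies in Hz, and keep every double coset HgH as rich in uncovered elements as Hg⁻¹H.
-- Then an uncovered x has an uncovered partner y = a x⁻¹ b in Hx⁻¹H, and t = b⁻¹ x lies in Hx
-- while t⁻¹ lies in Hy; adding t and t⁻¹ to T covers Hx and Hy, removing |H| uncovered elements
-- from each of HxH and Hx⁻¹H. Odd order is needed only for Hx ≠ Hy: otherwise t² ∈ H, yet t is
-- a power of t² because a group of odd order has no involutions.
module Submission where

open import Defs
import Algebra.Properties.Group as GroupProperties
import Algebra.Properties.Monoid.Mult as MonoidMultiplication
open import Algebra.Bundles using (Group)
open import Algebra.Structures using (IsGroup)
open import Data.Bool.Base using (if_then_else_)
open import Data.Fin.Base using (Fin; zero; suc; toℕ) renaming (_<_ to _<ᶠ_)
open import Data.Fin.Permutation using (Permutation; permutation; _⟨$⟩ʳ_)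
open import Data.Fin.Properties using (_≟_; any?; pigeonhole; <-cmp; _<?_)
open import Data.Fin.Subset using (Subset; _∈_; _∉_; _∪_; _∩_; ∁; ⁅_⁆)
open import Data.Fin.Subset.Properties
  using (_∈?_; x∈p∪q⁺; x∈p∪q⁻; x∈p∩q⁺; x∈p∩q⁻; x∈⁅x⁆; x∈⁅y⁆⇒x≡y; x≢y⇒x∉⁅y⁆; x∉⁅y⁆⇒x≢y; x∉p⇒x∈∁p; x∈∁p⇒x∉p)
open import Data.Nat.Base using (ℕ; zero; suc; _+_; _*_; _≤_; _<_; z≤n; s≤s)
open import Data.Nat.Divisibility using (_∣_; divides)
open import Data.Nat.Induction using (<-wellFounded)
open import Data.Nat.Properties
  using (+-suc; +-comm; +-assoc; +-identityʳ; *-comm; +-cancelˡ-≡; ≤-trans; m≤n+m; m≤n⇒m≤1+n; n<1+n; <-asym; m≤n⇒∃[o]m+o≡n; +-0-commutativeMonoid)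
open import Algebra.Properties.CommutativeMonoid.Sum +-0-commutativeMonoid using (sum; sum-permute)
open import Data.Product.Base using (∃; ∃-syntax; Σ; _×_; _,_; proj₁; proj₂)
open import Data.Sum.Base using (_⊎_; inj₁; inj₂)
open import Function.Base using (_∘_)
open import Induction.WellFounded using (Acc; acc)
open import Level using (Level; 0ℓ)
open import Relation.Binary.Definitions using (tri<; tri≈; tri>)
open import Relation.Binary.PropositionalEquality using (_≡_; _≢_; refl; sym; trans; cong; cong₂; subst; module ≡-Reasoning)
open import Relation.Nullary using (¬_; Dec; yes; no; does; contradiction)
open import Relation.Nullary.Decidable using (_×-dec_; decidable-stable)
open import Relation.Unary using (Pred; Decidable; _⊆_; _≐_)
open import Relation.Unary.Properties using (_∩?_; ∁?)

private
  variable
    p q : Level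
    n : ℕ

count : {P : Pred (Fin n) p} → Decidable P → ℕ
count P? = sum (λ i → if does (P? i) then 1 else 0)

count-cong : {P : Pred (Fin n) p} {Q : Pred (Fin n) q} (P? : Decidable P) (Q? : Decidable Q) →
             P ≐ Q → count P? ≡ count Q?
count-cong {n = zero}  P? Q? P≐Q = refl
count-cong {n = suc n} P? Q? (P⊆Q , Q⊆P) with P? zero | Q? zero
... | yes _ | yes _ = cong suc (count-cong (P? ∘ suc) (Q? ∘ suc) (P⊆Q , Q⊆P))
... | no _  | no _  = count-cong (P? ∘ suc) (Q? ∘ suc) (P⊆Q , Q⊆P)
... | yes p | no ¬q = contradiction (P⊆Q p) ¬q
... | no ¬p | yes q = contradiction (Q⊆P q) ¬p

count-permute : {P : Pred (Fin n) p} (P? : Decidable P) (π : Permutation n n) →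
                count P? ≡ count (P? ∘ (π ⟨$⟩ʳ_))
count-permute P? = sum-permute (λ i → if does (P? i) then 1 else 0)

count-split : {P : Pred (Fin n) p} {Q : Pred (Fin n) q} (P? : Decidable P) (Q? : Decidable Q) →
              count P? ≡ count (P? ∩? Q?) + count (P? ∩? ∁? Q?)
count-split {n = zero}  P? Q? = refl
count-split {n = suc n} P? Q? with P? zero | Q? zero | count-split (P? ∘ suc) (Q? ∘ suc)
... | yes _ | yes _ | ih = cong suc ih
... | yes _ | no _  | ih = trans (cong suc ih) (sym (+-suc _ _))
... | no _  | yes _ | ih = ih
... | no _  | no _  | ih = ih

count-complement : {P : Pred (Fin n) p} (P? : Decidable P) → count P? + count (∁? P?) ≡ n
count-complement {n = zero}  P? = refl
count-complement {n = suc n} P? with P? zero | count-complement (P? ∘ suc)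
... | yes _ | ih = cong suc ih
... | no _  | ih = trans (+-suc _ _) (cong suc ih)

count-empty : {P : Pred (Fin n) p} (P? : Decidable P) → (∀ i → ¬ P i) → count P? ≡ 0
count-empty {n = zero}  P? none = refl
count-empty {n = suc n} P? none with P? zero
... | yes p = contradiction p (none zero)
... | no _  = count-empty (P? ∘ suc) (none ∘ suc)

count-witness : {P : Pred (Fin n) p} (P? : Decidable P) → 0 < count P? → ∃ P
count-witness {n = suc n} P? pos with P? zero
... | yes p = zero , p
... | no _  with count-witness (P? ∘ suc) pos
...   | i , p = suc i , p

count-pos : {P : Pred (Fin n) p} (P? : Decidable P) {i : Fin n} → P i → 0 < count P?
count-pos {n = suc n} P? {zero} p with P? zero
... | yes _ = s≤s z≤n
... | no ¬p = contradiction p ¬p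
count-pos {n = suc n} P? {suc i} p = ≤-trans (count-pos (P? ∘ suc) p) (m≤n+m _ _)

count-mono : {P : Pred (Fin n) p} {Q : Pred (Fin n) q} (P? : Decidable P) (Q? : Decidable Q) →
             P ⊆ Q → count P? ≤ count Q?
count-mono {n = zero}  P? Q? P⊆Q = z≤n
count-mono {n = suc n} P? Q? P⊆Q with P? zero | Q? zero | count-mono (P? ∘ suc) (Q? ∘ suc) P⊆Q
... | yes _ | yes _ | ih = s≤s ih
... | yes p | no ¬q | ih = contradiction (P⊆Q p) ¬q
... | no _  | yes _ | ih = m≤n⇒m≤1+n ih
... | no _  | no _  | ih = ih

count-strictMono : {P : Pred (Fin n) p} {Q : Pred (Fin n) q} (P? : Decidable P) (Q? : Decidable Q) →
                   P ⊆ Q → {i : Fin n} → Q i → ¬ P i → count P? < count Q?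
count-strictMono {n = suc n} P? Q? P⊆Q {zero} q ¬p with P? zero | Q? zero
... | yes p | _     = contradiction p ¬p
... | no _  | no ¬q = contradiction q ¬q
... | no _  | yes _ = s≤s (count-mono (P? ∘ suc) (Q? ∘ suc) P⊆Q)
count-strictMono {n = suc n} P? Q? P⊆Q {suc i} q ¬p
  with P? zero | Q? zero | count-strictMono (P? ∘ suc) (Q? ∘ suc) P⊆Q q ¬p
... | yes _ | yes _ | ih = s≤s ih
... | yes p | no ¬q | ih = contradiction (P⊆Q p) ¬q
... | no _  | yes _ | ih = m≤n⇒m≤1+n ih
... | no _  | no _  | ih = ih

-- The points i < τ i and the points τ i < i are equinumerous, being swapped by τ.
fixedPointFreeInvolution⇒even : (τ : Fin n → Fin n) → (∀ i → τ (τ i) ≡ i) → (∀ i → τ i ≢ i) → 2 ∣ n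
fixedPointFreeInvolution⇒even {n} τ involutive fixedPointFree = divides (count below) (begin
  n                                ≡⟨ count-complement below ⟨
  count below + count (∁? below)   ≡⟨ cong (count below +_) count-above ⟩
  count below + count below        ≡⟨ cong (count below +_) (+-identityʳ (count below)) ⟨
  2 * count below                  ≡⟨ *-comm 2 (count below) ⟩
  count below * 2                  ∎)
  where
  open ≡-Reasoning
  below : Decidable (λ i → i <ᶠ τ i)
  below i = i <? τ i
  above : Decidable (λ i → τ i <ᶠ i)
  above i = τ i <? i
  π : Permutation n n
  π = permutation τ τ involutive involutive
  ¬below⇒above : ∀ {i} → ¬ i <ᶠ τ i → τ i <ᶠ i
  ¬below⇒above {i} i≮τi with <-cmp i (τ i)
  ... | tri< i<τi _ _ = contradiction i<τi i≮τi
  ... | tri≈ _ i≡τi _ = contradiction (sym i≡τi) (fixedPointFree i)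
  ... | tri> _ _ τi<i = τi<i
  count-above : count (∁? below) ≡ count below
  count-above = begin
    count (∁? below)   ≡⟨ count-cong (∁? below) above (¬below⇒above , λ τi<i i<τi → <-asym i<τi τi<i) ⟩
    count above        ≡⟨ count-permute above π ⟩
    count (above ∘ τ)  ≡⟨ count-cong (above ∘ τ) below
                            ( (λ {i} h → subst (λ j → j <ᶠ τ i) (involutive i) h)
                            , (λ {i} h → subst (λ j → j <ᶠ τ i) (sym (involutive i)) h)) ⟩
    count below        ∎

data Parity : ℕ → Set where
  even : ∀ m → Parity (m + m)
  odd  : ∀ m → Parity (suc (m + m))

parity : ∀ k → Parity k
parity zero = even zero
parity (suc k) with parity k
... | even m = odd m
... | odd m  = subst Parity (cong suc (+-suc m m)) (even (suc m))

module _ {n : ℕ} (G : FiniteGroup n) where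
  open FiniteGroup G
  open IsGroup isGroup using (assoc; identityˡ; identityʳ; inverseʳ)
  open ≡-Reasoning

  group : Group 0ℓ 0ℓ
  group = record { Carrier = Fin n ; _≈_ = _≡_ ; _∙_ = _∙_ ; ε = ε ; _⁻¹ = _⁻¹ ; isGroup = isGroup }

  open GroupProperties group
    using (⁻¹-involutive; ⁻¹-anti-homo-∙; ⁻¹-injective; ε⁻¹≈ε; identityʳ-unique;
           \\-leftDividesˡ; \\-leftDividesʳ; //-rightDividesˡ; //-rightDividesʳ)
  open MonoidMultiplication (Group.monoid group) using (×-homo-+; ×-assocˡ) renaming (_×_ to _·_)

  x∙y⁻¹∙y≡x : ∀ x y → x ∙ y ⁻¹ ∙ y ≡ x
  x∙y⁻¹∙y≡x x y = //-rightDividesˡ y x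

  x∙y∙y⁻¹≡x : ∀ x y → x ∙ y ∙ y ⁻¹ ≡ x
  x∙y∙y⁻¹≡x x y = //-rightDividesʳ y x

  infixr 8 _^_
  _^_ : Fin n → ℕ → Fin n
  t ^ k = k · t

  ^-+ : ∀ t j k → t ^ (j + k) ≡ t ^ j ∙ t ^ k
  ^-+ = ×-homo-+

  ^-* : ∀ t j k → (t ^ k) ^ j ≡ t ^ (j * k)
  ^-* = ×-assocˡ

  finiteOrder : ∀ t → ∃[ k ] t ^ suc k ≡ ε
  finiteOrder t with pigeonhole (n<1+n n) (λ (i : Fin (suc n)) → t ^ toℕ i)
  ... | i , j , i<j , tⁱ≡tʲ with m≤n⇒∃[o]m+o≡n i<j
  ...   | k , i+1+k≡j = k , identityʳ-unique (t ^ toℕ i) (t ^ suc k) (begin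
    t ^ toℕ i ∙ t ^ suc k  ≡⟨ ^-+ t (toℕ i) (suc k) ⟨
    t ^ (toℕ i + suc k)    ≡⟨ cong (t ^_) (trans (+-suc (toℕ i) k) i+1+k≡j) ⟩
    t ^ toℕ j              ≡⟨ tⁱ≡tʲ ⟨
    t ^ toℕ i              ∎)

  module _ (2∤n : ¬ 2 ∣ n) where

    involution⇒ε : ∀ {s} → s ∙ s ≡ ε → s ≡ ε
    involution⇒ε {s} s∙s≡ε = decidable-stable (s ≟ ε) λ s≢ε →
      2∤n (fixedPointFreeInvolution⇒even (_∙ s) ∙s∙s≡id (λ z z∙s≡z → s≢ε (identityʳ-unique z s z∙s≡z)))
      where
      ∙s∙s≡id : ∀ z → z ∙ s ∙ s ≡ z
      ∙s∙s≡id z = trans (assoc z s s) (trans (cong (z ∙_) s∙s≡ε) (identityʳ z))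

    halvePeriod : ∀ {t} m → t ^ (m + m) ≡ ε → t ^ m ≡ ε
    halvePeriod {t} m t²ᵐ≡ε = involution⇒ε (trans (sym (^-+ t m m)) t²ᵐ≡ε)

    oddPeriod : ∀ {t} k → Acc _<_ k → 0 < k → t ^ k ≡ ε → ∃[ m ] t ^ suc (m + m) ≡ ε
    oddPeriod k _ pos tᵏ≡ε with parity k
    oddPeriod _ _            pos tᵏ≡ε | odd m        = m , tᵏ≡ε
    oddPeriod _ _            ()  tᵏ≡ε | even zero
    oddPeriod _ (acc smaller) pos tᵏ≡ε | even (suc m) =
      oddPeriod (suc m) (smaller (s≤s (m≤n+m (suc m) m))) (s≤s z≤n) (halvePeriod (suc m) tᵏ≡ε)

    square-generates : ∀ t → ∃[ m ] (t ^ 2) ^ m ≡ t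
    square-generates t with finiteOrder t
    ... | k , tᵏ≡ε with oddPeriod (suc k) (<-wellFounded (suc k)) (s≤s z≤n) tᵏ≡ε
    ...   | m , t²ᵐ⁺¹≡ε = suc m , (begin
      (t ^ 2) ^ suc m        ≡⟨ ^-* t (suc m) 2 ⟩
      t ^ (2 + m * 2)        ≡⟨ cong (λ j → t ^ (2 + j)) (trans (*-comm m 2) (cong (m +_) (+-identityʳ m))) ⟩
      t ∙ t ^ suc (m + m)    ≡⟨ cong (t ∙_) t²ᵐ⁺¹≡ε ⟩
      t ∙ ε                  ≡⟨ identityʳ t ⟩
      t                      ∎)

  module _ (H : Subset n) (H-subgroup : IsSubgroup G H) where

    ε∈H : ε ∈ H
    ε∈H = proj₁ H-subgroup

    ∙-closed : ∀ {x y} → x ∈ H → y ∈ H → x ∙ y ∈ H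
    ∙-closed = proj₁ (proj₂ H-subgroup) _ _

    ⁻¹-closed : ∀ {x} → x ∈ H → x ⁻¹ ∈ H
    ⁻¹-closed = proj₂ (proj₂ H-subgroup) _

    ⁻¹-closed⁻ : ∀ {x} → x ⁻¹ ∈ H → x ∈ H
    ⁻¹-closed⁻ {x} x⁻¹∈H = subst (_∈ H) (⁻¹-involutive x) (⁻¹-closed x⁻¹∈H)

    ^-closed : ∀ {t} k → t ∈ H → t ^ k ∈ H
    ^-closed zero    t∈H = ε∈H
    ^-closed (suc k) t∈H = ∙-closed t∈H (^-closed k t∈H)

    square∈H⇒∈H : ¬ 2 ∣ n → ∀ {t} → t ∙ t ∈ H → t ∈ H
    square∈H⇒∈H 2∤n {t} t∙t∈H with square-generates 2∤n t
    ... | m , [t²]ᵐ≡t = subst (_∈ H) [t²]ᵐ≡t (^-closed m (subst (_∈ H) (cong (t ∙_) (sym (identityʳ t))) t∙t∈H))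

    infix 4 _~_ _~?_ _≋_ _≋?_

    _~_ : Fin n → Fin n → Set
    z ~ w = z ∙ w ⁻¹ ∈ H

    _~?_ : ∀ z w → Dec (z ~ w)
    z ~? w = z ∙ w ⁻¹ ∈? H

    ~-refl : ∀ z → z ~ z
    ~-refl z = subst (_∈ H) (sym (inverseʳ z)) ε∈H

    ~-sym : ∀ {z w} → z ~ w → w ~ z
    ~-sym {z} {w} z~w = subst (_∈ H) eq (⁻¹-closed z~w)
      where
      eq : (z ∙ w ⁻¹) ⁻¹ ≡ w ∙ z ⁻¹
      eq = trans (⁻¹-anti-homo-∙ z (w ⁻¹)) (cong (_∙ z ⁻¹) (⁻¹-involutive w))

    ~-trans : ∀ {u v w} → u ~ v → v ~ w → u ~ w
    ~-trans {u} {v} {w} u~v v~w = subst (_∈ H) eq (∙-closed u~v v~w)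
      where
      eq : u ∙ v ⁻¹ ∙ (v ∙ w ⁻¹) ≡ u ∙ w ⁻¹
      eq = trans (assoc u (v ⁻¹) (v ∙ w ⁻¹)) (cong (u ∙_) (\\-leftDividesʳ v (w ⁻¹)))

    ∈H⇒~ε : ∀ {z} → z ∈ H → z ~ ε
    ∈H⇒~ε {z} z∈H = subst (_∈ H) (sym (trans (cong (z ∙_) ε⁻¹≈ε) (identityʳ z))) z∈H

    ~-∈H : ∀ {z w} → z ~ w → w ∈ H → z ∈ H
    ~-∈H {z} {w} z~w w∈H = subst (_∈ H) (x∙y⁻¹∙y≡x z w) (∙-closed z~w w∈H)

    ∈H⇒∙~ : ∀ {z} w → z ∈ H → z ∙ w ~ w
    ∈H⇒∙~ {z} w z∈H = subst (_∈ H) (sym (x∙y∙y⁻¹≡x z w)) z∈H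

    ∙~⇒∈H : ∀ {z} w → z ∙ w ~ w → z ∈ H
    ∙~⇒∈H {z} w z∙w~w = subst (_∈ H) (x∙y∙y⁻¹≡x z w) z∙w~w

    ~⁻¹⇒∙∈H : ∀ {z w} → z ~ w ⁻¹ → z ∙ w ∈ H
    ~⁻¹⇒∙∈H {z} {w} = subst (_∈ H) (cong (z ∙_) (⁻¹-involutive w))

    _≋_ : Fin n → Fin n → Set
    z ≋ g = ∃[ a ] ∃[ b ] a ∈ H × b ∈ H × z ≡ a ∙ g ∙ b

    _≋?_ : ∀ z g → Dec (z ≋ g)
    z ≋? g = any? λ a → any? λ b → a ∈? H ×-dec b ∈? H ×-dec z ≟ a ∙ g ∙ b

    ≋-refl : ∀ z → z ≋ z
    ≋-refl z = ε , ε , ε∈H , ε∈H , sym (trans (identityʳ (ε ∙ z)) (identityˡ z))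

    ≋-sym : ∀ {z g} → z ≋ g → g ≋ z
    ≋-sym {z} {g} (a , b , a∈H , b∈H , z≡agb) = a ⁻¹ , b ⁻¹ , ⁻¹-closed a∈H , ⁻¹-closed b∈H , sym (begin
      a ⁻¹ ∙ z ∙ b ⁻¹              ≡⟨ cong (λ u → a ⁻¹ ∙ u ∙ b ⁻¹) z≡agb ⟩
      a ⁻¹ ∙ (a ∙ g ∙ b) ∙ b ⁻¹    ≡⟨ cong (_∙ b ⁻¹) (assoc (a ⁻¹) (a ∙ g) b) ⟨
      a ⁻¹ ∙ (a ∙ g) ∙ b ∙ b ⁻¹    ≡⟨ x∙y∙y⁻¹≡x _ b ⟩
      a ⁻¹ ∙ (a ∙ g)               ≡⟨ \\-leftDividesʳ a g ⟩
      g                            ∎)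

    ≋-trans : ∀ {z g w} → z ≋ g → g ≋ w → z ≋ w
    ≋-trans {z} {g} {w} (a , b , a∈H , b∈H , z≡agb) (c , d , c∈H , d∈H , g≡cwd) =
      a ∙ c , d ∙ b , ∙-closed a∈H c∈H , ∙-closed d∈H b∈H , (begin
        z                        ≡⟨ z≡agb ⟩
        a ∙ g ∙ b                ≡⟨ cong (λ u → a ∙ u ∙ b) g≡cwd ⟩
        a ∙ (c ∙ w ∙ d) ∙ b      ≡⟨ cong (_∙ b) (assoc a (c ∙ w) d) ⟨
        a ∙ (c ∙ w) ∙ d ∙ b      ≡⟨ assoc (a ∙ (c ∙ w)) d b ⟩
        a ∙ (c ∙ w) ∙ (d ∙ b)    ≡⟨ cong (_∙ (d ∙ b)) (assoc a c w) ⟨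
        a ∙ c ∙ w ∙ (d ∙ b)      ∎)

    ≋-⁻¹ : ∀ {z g} → z ≋ g → z ⁻¹ ≋ g ⁻¹
    ≋-⁻¹ {z} {g} (a , b , a∈H , b∈H , z≡agb) = b ⁻¹ , a ⁻¹ , ⁻¹-closed b∈H , ⁻¹-closed a∈H , (begin
      z ⁻¹                     ≡⟨ cong _⁻¹ z≡agb ⟩
      (a ∙ g ∙ b) ⁻¹           ≡⟨ ⁻¹-anti-homo-∙ (a ∙ g) b ⟩
      b ⁻¹ ∙ (a ∙ g) ⁻¹        ≡⟨ cong (b ⁻¹ ∙_) (⁻¹-anti-homo-∙ a g) ⟩
      b ⁻¹ ∙ (g ⁻¹ ∙ a ⁻¹)     ≡⟨ assoc (b ⁻¹) (g ⁻¹) (a ⁻¹) ⟨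
      b ⁻¹ ∙ g ⁻¹ ∙ a ⁻¹       ∎)

    ⁻¹≋⇒≋⁻¹ : ∀ {z g} → z ⁻¹ ≋ g → z ≋ g ⁻¹
    ⁻¹≋⇒≋⁻¹ {z} z⁻¹≋g = subst (_≋ _) (⁻¹-involutive z) (≋-⁻¹ z⁻¹≋g)

    ≋⁻¹⇒⁻¹≋ : ∀ {z g} → z ≋ g ⁻¹ → z ⁻¹ ≋ g
    ≋⁻¹⇒⁻¹≋ {g = g} z≋g⁻¹ = subst (_ ≋_) (⁻¹-involutive g) (≋-⁻¹ z≋g⁻¹)

    ~⇒≋ : ∀ {z w} → z ~ w → z ≋ w
    ~⇒≋ {z} {w} z~w = z ∙ w ⁻¹ , ε , z~w , ε∈H , sym (trans (identityʳ _) (x∙y⁻¹∙y≡x z w))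


    ∣H∣ : ℕ
    ∣H∣ = count (_∈? H)

    CosetClosed : Pred (Fin n) p → Set p
    CosetClosed P = ∀ {z w} → z ~ w → P w → P z

    rightTranslation : Fin n → Permutation n n
    rightTranslation w = permutation (_∙ w) (_∙ w ⁻¹) (λ z → x∙y⁻¹∙y≡x z w) (λ z → x∙y∙y⁻¹≡x z w)

    count-coset : ∀ w → count (_~? w) ≡ ∣H∣
    count-coset w = trans (count-permute (_~? w) (rightTranslation w)) (count-cong ((_~? w) ∘ (_∙ w)) (_∈? H) (∙~⇒∈H w , ∈H⇒∙~ w))

    count-∩coset-inside : {P : Pred (Fin n) p} (P? : Decidable P) → CosetClosed P →
                          ∀ {w} → P w → count (P? ∩? (_~? w)) ≡ ∣H∣
    count-∩coset-inside P? P-closed {w} Pw =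
      trans (count-cong (P? ∩? (_~? w)) (_~? w) (proj₂ , λ z~w → P-closed z~w Pw , z~w)) (count-coset w)

    count-∩coset-outside : {P : Pred (Fin n) p} (P? : Decidable P) → CosetClosed P →
                           ∀ {w} → ¬ P w → count (P? ∩? (_~? w)) ≡ 0
    count-∩coset-outside P? P-closed {w} ¬Pw =
      count-empty (P? ∩? (_~? w)) λ z (Pz , z~w) → ¬Pw (P-closed (~-sym z~w) Pz)

    count-∩coset-cong : {P : Pred (Fin n) p} {Q : Pred (Fin n) q} (P? : Decidable P) (Q? : Decidable Q) →
                        CosetClosed P → CosetClosed Q → ∀ {v w} → (P v → Q w) → (Q w → P v) →
                        count (P? ∩? (_~? v)) ≡ count (Q? ∩? (_~? w))
    count-∩coset-cong P? Q? P-closed Q-closed {v} Pv⇒Qw Qw⇒Pv with P? v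
    ... | yes Pv = trans (count-∩coset-inside P? P-closed Pv) (sym (count-∩coset-inside Q? Q-closed (Pv⇒Qw Pv)))
    ... | no ¬Pv = trans (count-∩coset-outside P? P-closed ¬Pv) (sym (count-∩coset-outside Q? Q-closed (¬Pv ∘ Qw⇒Pv)))

    ≋-cosetClosed : ∀ g → CosetClosed (_≋ g)
    ≋-cosetClosed g z~w w≋g = ≋-trans (~⇒≋ z~w) w≋g

    ≋-inversePair : ∀ {x y g} → y ≋ x ⁻¹ → x ≋ g ⁻¹ → y ≋ g
    ≋-inversePair y≋x⁻¹ x≋g⁻¹ = ≋-trans y≋x⁻¹ (≋⁻¹⇒⁻¹≋ x≋g⁻¹)

    ≋-inversePair⁻ : ∀ {x y g} → y ≋ x ⁻¹ → y ≋ g → x ≋ g ⁻¹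
    ≋-inversePair⁻ y≋x⁻¹ y≋g = ⁻¹≋⇒≋⁻¹ (≋-trans (≋-sym y≋x⁻¹) y≋g)

    ≋⁻¹⇒pairing : ∀ {x y} → y ≋ x ⁻¹ → ∃[ t ] t ~ x × t ⁻¹ ~ y
    ≋⁻¹⇒pairing {x} {y} (a , b , a∈H , b∈H , y≡ax⁻¹b) = t , t~x , t⁻¹~y
      where
      t = b ⁻¹ ∙ x
      t~x : t ~ x
      t~x = subst (_∈ H) (sym (x∙y∙y⁻¹≡x (b ⁻¹) x)) (⁻¹-closed b∈H)
      y∙t≡a : y ∙ t ≡ a
      y∙t≡a = begin
        y ∙ t                              ≡⟨ cong (_∙ t) y≡ax⁻¹b ⟩
        a ∙ x ⁻¹ ∙ b ∙ (b ⁻¹ ∙ x)          ≡⟨ assoc (a ∙ x ⁻¹) b t ⟩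
        a ∙ x ⁻¹ ∙ (b ∙ (b ⁻¹ ∙ x))        ≡⟨ cong (a ∙ x ⁻¹ ∙_) (\\-leftDividesˡ b x) ⟩
        a ∙ x ⁻¹ ∙ x                       ≡⟨ x∙y⁻¹∙y≡x a x ⟩
        a                                  ∎
      t⁻¹~y : t ⁻¹ ~ y
      t⁻¹~y = subst (_∈ H) (⁻¹-anti-homo-∙ y t) (⁻¹-closed (subst (_∈ H) (sym y∙t≡a) a∈H))

    Covered : Subset n → Pred (Fin n) 0ℓ
    Covered T z = ∃[ s ] s ∈ T × s ~ z

    covered? : ∀ T → Decidable (Covered T)
    covered? T z = any? λ s → s ∈? T ×-dec s ~? z

    Uncovered : Subset n → Pred (Fin n) 0ℓ
    Uncovered T z = ¬ Covered T z

    uncovered? : ∀ T → Decidable (Uncovered T)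
    uncovered? T = ∁? (covered? T)

    uncovered-cosetClosed : ∀ T → CosetClosed (Uncovered T)
    uncovered-cosetClosed T z~w w-unc (s , s∈T , s~z) = w-unc (s , s∈T , ~-trans s~z z~w)

    record IsPartialTransversal (T : Subset n) : Set where
      field
        ε∈T           : ε ∈ T
        inverseClosed : InverseClosed G T
        separated     : ∀ {s s′} → s ∈ T → s′ ∈ T → s ~ s′ → s ≡ s′

    -- With S = T ∖ {ε}, the neighbours c ∈ H of x ∉ H correspond to the elements c x⁻¹ of T
    -- in the coset H x⁻¹, of which there is exactly one.
    transversal⇒perfectCode : ∀ {T} → IsPartialTransversal T → (∀ z → Covered T z) → IsPerfectCodeOf G H
    transversal⇒perfectCode {T} T-transversal covers = S , S-inverseClosed , ε∉S , independent , dominated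
      where
      open IsPartialTransversal T-transversal
      S : Subset n
      S = T ∩ ∁ ⁅ ε ⁆

      ∈S⁺ : ∀ {s} → s ∈ T → s ≢ ε → s ∈ S
      ∈S⁺ s∈T s≢ε = x∈p∩q⁺ (s∈T , x∉p⇒x∈∁p (x≢y⇒x∉⁅y⁆ s≢ε))

      ∈S⁻ : ∀ {s} → s ∈ S → s ∈ T × s ≢ ε
      ∈S⁻ s∈S with x∈p∩q⁻ T _ s∈S
      ... | s∈T , s∈∁ε = s∈T , x∉⁅y⁆⇒x≢y (x∈∁p⇒x∉p s∈∁ε)

      S-inverseClosed : InverseClosed G S
      S-inverseClosed s s∈S with ∈S⁻ s∈S
      ... | s∈T , s≢ε = ∈S⁺ (inverseClosed s s∈T) λ s⁻¹≡ε → s≢ε (⁻¹-injective (trans s⁻¹≡ε (sym ε⁻¹≈ε)))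

      ε∉S : ε ∉ S
      ε∉S ε∈S = proj₂ (∈S⁻ ε∈S) refl

      ∈T∩H⇒ε : ∀ {s} → s ∈ T → s ∈ H → s ≡ ε
      ∈T∩H⇒ε s∈T s∈H = separated s∈T ε∈T (∈H⇒~ε s∈H)

      independent : ∀ x y → x ∈ H → y ∈ H → ¬ Adj G S x y
      independent x y x∈H y∈H (_ , y∙x⁻¹∈S) with ∈S⁻ y∙x⁻¹∈S
      ... | y∙x⁻¹∈T , y∙x⁻¹≢ε = y∙x⁻¹≢ε (∈T∩H⇒ε y∙x⁻¹∈T (∙-closed y∈H (⁻¹-closed x∈H)))

      dominated : ∀ x → x ∉ H → Σ (Fin n) λ c → c ∈ H × Adj G S x c × (∀ c′ → c′ ∈ H → Adj G S x c′ → c′ ≡ c)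
      dominated x x∉H with covers (x ⁻¹)
      ... | s , s∈T , s~x⁻¹ = s ∙ x , s∙x∈H , (x≢s∙x , subst (_∈ S) (sym (x∙y∙y⁻¹≡x s x)) (∈S⁺ s∈T s≢ε)) , unique
        where
        s∙x∈H : s ∙ x ∈ H
        s∙x∈H = ~⁻¹⇒∙∈H s~x⁻¹
        x≢s∙x : x ≢ s ∙ x
        x≢s∙x x≡s∙x = x∉H (subst (_∈ H) (sym x≡s∙x) s∙x∈H)
        s≢ε : s ≢ ε
        s≢ε s≡ε = x∉H (⁻¹-closed⁻ (~-∈H (~-sym s~x⁻¹) (subst (_∈ H) (sym s≡ε) ε∈H)))
        unique : ∀ c′ → c′ ∈ H → Adj G S x c′ → c′ ≡ s ∙ x
        unique c′ c′∈H (_ , c′∙x⁻¹∈S) = begin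
          c′                  ≡⟨ x∙y⁻¹∙y≡x c′ x ⟨
          c′ ∙ x ⁻¹ ∙ x       ≡⟨ cong (_∙ x) (separated (proj₁ (∈S⁻ c′∙x⁻¹∈S)) s∈T (~-trans (∈H⇒∙~ (x ⁻¹) c′∈H) (~-sym s~x⁻¹))) ⟩
          s ∙ x               ∎

    uncoveredIn : Subset n → Fin n → ℕ
    uncoveredIn T g = count (uncovered? T ∩? (_≋? g))

    Balanced : Subset n → Set
    Balanced T = ∀ g → uncoveredIn T g ≡ uncoveredIn T (g ⁻¹)

    balanced⇒partner : ∀ {T x} → Balanced T → Uncovered T x → ∃[ y ] Uncovered T y × y ≋ x ⁻¹
    balanced⇒partner {T} {x} T-balanced x-unc = count-witness (uncovered? T ∩? (_≋? x ⁻¹))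
      (subst (0 <_) (T-balanced x) (count-pos (uncovered? T ∩? (_≋? x)) (x-unc , ≋-refl x)))

    ⁅ε⁆-transversal : IsPartialTransversal ⁅ ε ⁆
    ⁅ε⁆-transversal = record
      { ε∈T           = x∈⁅x⁆ ε
      ; inverseClosed = λ s s∈⁅ε⁆ → subst (_∈ ⁅ ε ⁆) (sym (trans (cong _⁻¹ (x∈⁅y⁆⇒x≡y ε s∈⁅ε⁆)) ε⁻¹≈ε)) (x∈⁅x⁆ ε)
      ; separated     = λ s∈⁅ε⁆ s′∈⁅ε⁆ _ → trans (x∈⁅y⁆⇒x≡y ε s∈⁅ε⁆) (sym (x∈⁅y⁆⇒x≡y ε s′∈⁅ε⁆))
      }

    uncovered-⁅ε⁆⁻ : ∀ {z} → Uncovered ⁅ ε ⁆ z → z ∉ H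
    uncovered-⁅ε⁆⁻ z-unc z∈H = z-unc (ε , x∈⁅x⁆ ε , ~-sym (∈H⇒~ε z∈H))

    uncovered-⁅ε⁆⁺ : ∀ {z} → z ∉ H → Uncovered ⁅ ε ⁆ z
    uncovered-⁅ε⁆⁺ z∉H (s , s∈⁅ε⁆ , s~z) with x∈⁅y⁆⇒x≡y ε s∈⁅ε⁆
    ... | refl = z∉H (~-∈H (~-sym s~z) ε∈H)

    -- The points left uncovered by {ε} form the inversion-invariant set G ∖ H.
    ⁅ε⁆-balanced : Balanced ⁅ ε ⁆
    ⁅ε⁆-balanced g =
      trans (count-permute (uncovered? ⁅ ε ⁆ ∩? (_≋? g)) inversion)
            (count-cong ((uncovered? ⁅ ε ⁆ ∩? (_≋? g)) ∘ _⁻¹) (uncovered? ⁅ ε ⁆ ∩? (_≋? g ⁻¹))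
              ( (λ (z⁻¹-unc , z⁻¹≋g) → uncovered-⁅ε⁆⁺ (uncovered-⁅ε⁆⁻ z⁻¹-unc ∘ ⁻¹-closed) , ⁻¹≋⇒≋⁻¹ z⁻¹≋g)
              , (λ (z-unc , z≋g⁻¹) → uncovered-⁅ε⁆⁺ (uncovered-⁅ε⁆⁻ z-unc ∘ ⁻¹-closed⁻) , ≋⁻¹⇒⁻¹≋ z≋g⁻¹)))
      where
      inversion : Permutation n n
      inversion = permutation _⁻¹ _⁻¹ ⁻¹-involutive ⁻¹-involutive

    module Extension (2∤n : ¬ 2 ∣ n) {T} (T-transversal : IsPartialTransversal T) (T-balanced : Balanced T)
                     {x y t} (x-unc : Uncovered T x) (y-unc : Uncovered T y) (y≋x⁻¹ : y ≋ x ⁻¹)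
                     (t~x : t ~ x) (t⁻¹~y : t ⁻¹ ~ y) where
      open IsPartialTransversal T-transversal

      x∉H : x ∉ H
      x∉H x∈H = x-unc (ε , ε∈T , ~-sym (∈H⇒~ε x∈H))

      t≁t⁻¹ : ¬ t ~ t ⁻¹
      t≁t⁻¹ t~t⁻¹ = x∉H (~-∈H (~-sym t~x) (square∈H⇒∈H 2∤n (~⁻¹⇒∙∈H t~t⁻¹)))

      x≁y : ¬ x ~ y
      x≁y x~y = t≁t⁻¹ (~-trans t~x (~-trans x~y (~-sym t⁻¹~y)))

      T′ : Subset n
      T′ = T ∪ ⁅ t ⁆ ∪ ⁅ t ⁻¹ ⁆

      New : Fin n → Set
      New s = s ≡ t ⊎ s ≡ t ⁻¹

      ∈T′⁻ : ∀ {s} → s ∈ T′ → s ∈ T ⊎ New s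
      ∈T′⁻ s∈T′ with x∈p∪q⁻ T _ s∈T′
      ... | inj₁ s∈T   = inj₁ s∈T
      ... | inj₂ s∈new with x∈p∪q⁻ ⁅ t ⁆ _ s∈new
      ...   | inj₁ s∈⁅t⁆   = inj₂ (inj₁ (x∈⁅y⁆⇒x≡y t s∈⁅t⁆))
      ...   | inj₂ s∈⁅t⁻¹⁆ = inj₂ (inj₂ (x∈⁅y⁆⇒x≡y (t ⁻¹) s∈⁅t⁻¹⁆))

      ∈T′⁺ : ∀ {s} → s ∈ T ⊎ New s → s ∈ T′
      ∈T′⁺ (inj₁ s∈T)         = x∈p∪q⁺ (inj₁ s∈T)
      ∈T′⁺ (inj₂ (inj₁ refl)) = x∈p∪q⁺ (inj₂ (x∈p∪q⁺ (inj₁ (x∈⁅x⁆ t))))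
      ∈T′⁺ (inj₂ (inj₂ refl)) = x∈p∪q⁺ (inj₂ (x∈p∪q⁺ (inj₂ (x∈⁅x⁆ (t ⁻¹)))))

      new-uncovered : ∀ {s} → New s → Uncovered T s
      new-uncovered (inj₁ refl) = uncovered-cosetClosed T t~x x-unc
      new-uncovered (inj₂ refl) = uncovered-cosetClosed T t⁻¹~y y-unc

      extended-transversal : IsPartialTransversal T′
      extended-transversal = record { ε∈T = ∈T′⁺ (inj₁ ε∈T) ; inverseClosed = inverseClosed′ ; separated = separated′ }
        where
        inverseClosed′ : InverseClosed G T′
        inverseClosed′ s s∈T′ with ∈T′⁻ s∈T′
        ... | inj₁ s∈T         = ∈T′⁺ (inj₁ (inverseClosed s s∈T))
        ... | inj₂ (inj₁ refl) = ∈T′⁺ (inj₂ (inj₂ refl))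
        ... | inj₂ (inj₂ refl) = ∈T′⁺ (inj₂ (inj₁ (⁻¹-involutive t)))

        separated′ : ∀ {s s′} → s ∈ T′ → s′ ∈ T′ → s ~ s′ → s ≡ s′
        separated′ {s} {s′} s∈T′ s′∈T′ s~s′ with ∈T′⁻ s∈T′ | ∈T′⁻ s′∈T′
        ... | inj₁ s∈T         | inj₁ s′∈T         = separated s∈T s′∈T s~s′
        ... | inj₁ s∈T         | inj₂ s′-new       = contradiction (s , s∈T , s~s′) (new-uncovered s′-new)
        ... | inj₂ s-new       | inj₁ s′∈T         = contradiction (s′ , s′∈T , ~-sym s~s′) (new-uncovered s-new)
        ... | inj₂ (inj₁ refl) | inj₂ (inj₁ refl) = refl
        ... | inj₂ (inj₂ refl) | inj₂ (inj₂ refl) = refl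
        ... | inj₂ (inj₁ refl) | inj₂ (inj₂ refl) = contradiction s~s′ t≁t⁻¹
        ... | inj₂ (inj₂ refl) | inj₂ (inj₁ refl) = contradiction (~-sym s~s′) t≁t⁻¹

      uncovered′⁻ : ∀ {z} → Uncovered T′ z → Uncovered T z × ¬ z ~ x × ¬ z ~ y
      uncovered′⁻ z-unc′ =
          (λ (s , s∈T , s~z) → z-unc′ (s , ∈T′⁺ (inj₁ s∈T) , s~z))
        , (λ z~x → z-unc′ (t , ∈T′⁺ (inj₂ (inj₁ refl)) , ~-trans t~x (~-sym z~x)))
        , (λ z~y → z-unc′ (t ⁻¹ , ∈T′⁺ (inj₂ (inj₂ refl)) , ~-trans t⁻¹~y (~-sym z~y)))

      uncovered′⁺ : ∀ {z} → Uncovered T z → ¬ z ~ x → ¬ z ~ y → Uncovered T′ z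
      uncovered′⁺ z-unc z≁x z≁y (s , s∈T′ , s~z) with ∈T′⁻ s∈T′
      ... | inj₁ s∈T         = z-unc (s , s∈T , s~z)
      ... | inj₂ (inj₁ refl) = z≁x (~-trans (~-sym s~z) t~x)
      ... | inj₂ (inj₂ refl) = z≁y (~-trans (~-sym s~z) t⁻¹~y)

      fewer-uncovered : count (uncovered? T′) < count (uncovered? T)
      fewer-uncovered = count-strictMono (uncovered? T′) (uncovered? T) (proj₁ ∘ uncovered′⁻) x-unc
                          (λ x-unc′ → proj₁ (proj₂ (uncovered′⁻ x-unc′)) (~-refl x))

      cosetIn : Fin n → Fin n → ℕ
      cosetIn w g = count ((_≋? g) ∩? (_~? w))

      uncoveredIn-split : ∀ g → uncoveredIn T g ≡ (cosetIn x g + cosetIn y g) + uncoveredIn T′ g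
      uncoveredIn-split g = begin
        uncoveredIn T g
          ≡⟨ count-split U∩D (_~? x) ⟩
        count (U∩D ∩? (_~? x)) + count (U∩D ∩? ∁? (_~? x))
          ≡⟨ cong₂ _+_ (count-cong (U∩D ∩? (_~? x)) ((_≋? g) ∩? (_~? x)) inHx) (count-split (U∩D ∩? ∁? (_~? x)) (_~? y)) ⟩
        cosetIn x g + (count (U∩D∖Hx ∩? (_~? y)) + count (U∩D∖Hx ∩? ∁? (_~? y)))
          ≡⟨ cong (cosetIn x g +_) (cong₂ _+_
               (count-cong (U∩D∖Hx ∩? (_~? y)) ((_≋? g) ∩? (_~? y)) inHy)
               (count-cong (U∩D∖Hx ∩? ∁? (_~? y)) (uncovered? T′ ∩? (_≋? g)) elsewhere)) ⟩
        cosetIn x g + (cosetIn y g + uncoveredIn T′ g)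
          ≡⟨ +-assoc (cosetIn x g) (cosetIn y g) (uncoveredIn T′ g) ⟨
        (cosetIn x g + cosetIn y g) + uncoveredIn T′ g
          ∎
        where
        U∩D : Decidable (λ z → Uncovered T z × z ≋ g)
        U∩D = uncovered? T ∩? (_≋? g)
        U∩D∖Hx : Decidable (λ z → (Uncovered T z × z ≋ g) × ¬ z ~ x)
        U∩D∖Hx = U∩D ∩? ∁? (_~? x)
        inHx : (λ z → (Uncovered T z × z ≋ g) × z ~ x) ≐ (λ z → z ≋ g × z ~ x)
        inHx = (λ ((_ , z≋g) , z~x) → z≋g , z~x)
             , (λ (z≋g , z~x) → (uncovered-cosetClosed T z~x x-unc , z≋g) , z~x)
        inHy : (λ z → ((Uncovered T z × z ≋ g) × ¬ z ~ x) × z ~ y) ≐ (λ z → z ≋ g × z ~ y)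
        inHy = (λ (((_ , z≋g) , _) , z~y) → z≋g , z~y)
             , (λ (z≋g , z~y) → ((uncovered-cosetClosed T z~y y-unc , z≋g) , λ z~x → x≁y (~-trans (~-sym z~x) z~y)) , z~y)
        elsewhere : (λ z → ((Uncovered T z × z ≋ g) × ¬ z ~ x) × ¬ z ~ y) ≐ (λ z → Uncovered T′ z × z ≋ g)
        elsewhere = (λ (((z-unc , z≋g) , z≁x) , z≁y) → uncovered′⁺ z-unc z≁x z≁y , z≋g)
                  , (λ (z-unc′ , z≋g) → let (z-unc , z≁x , z≁y) = uncovered′⁻ z-unc′ in ((z-unc , z≋g) , z≁x) , z≁y)

      cosetIn-x⁻¹ : ∀ g → cosetIn x (g ⁻¹) ≡ cosetIn y g
      cosetIn-x⁻¹ g = count-∩coset-cong (_≋? g ⁻¹) (_≋? g) (≋-cosetClosed _) (≋-cosetClosed _)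
                        (≋-inversePair y≋x⁻¹) (≋-inversePair⁻ y≋x⁻¹)

      cosetIn-y⁻¹ : ∀ g → cosetIn y (g ⁻¹) ≡ cosetIn x g
      cosetIn-y⁻¹ g = count-∩coset-cong (_≋? g ⁻¹) (_≋? g) (≋-cosetClosed _) (≋-cosetClosed _)
                        (≋-inversePair x≋y⁻¹) (≋-inversePair⁻ x≋y⁻¹)
        where
        x≋y⁻¹ : x ≋ y ⁻¹
        x≋y⁻¹ = ⁻¹≋⇒≋⁻¹ (≋-sym y≋x⁻¹)

      extended-balanced : Balanced T′
      extended-balanced g = +-cancelˡ-≡ (cosetIn x g + cosetIn y g) _ _ (begin
        (cosetIn x g + cosetIn y g) + uncoveredIn T′ g
          ≡⟨ uncoveredIn-split g ⟨
        uncoveredIn T g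
          ≡⟨ T-balanced g ⟩
        uncoveredIn T (g ⁻¹)
          ≡⟨ uncoveredIn-split (g ⁻¹) ⟩
        (cosetIn x (g ⁻¹) + cosetIn y (g ⁻¹)) + uncoveredIn T′ (g ⁻¹)
          ≡⟨ cong (_+ uncoveredIn T′ (g ⁻¹)) (trans (cong₂ _+_ (cosetIn-x⁻¹ g) (cosetIn-y⁻¹ g)) (+-comm (cosetIn y g) (cosetIn x g))) ⟩
        (cosetIn x g + cosetIn y g) + uncoveredIn T′ (g ⁻¹)
          ∎)

    complete : ¬ 2 ∣ n → ∀ {T} → IsPartialTransversal T → Balanced T → Acc _<_ (count (uncovered? T)) →
               ∃[ T′ ] IsPartialTransversal T′ × (∀ z → Covered T′ z)
    complete 2∤n {T} T-transversal T-balanced (acc smaller) with any? (uncovered? T)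
    ... | no all-covered = T , T-transversal , λ z → decidable-stable (covered? T z) (λ z-unc → all-covered (z , z-unc))
    ... | yes (x , x-unc) with balanced⇒partner T-balanced x-unc
    ...   | y , y-unc , y≋x⁻¹ with ≋⁻¹⇒pairing y≋x⁻¹
    ...     | t , t~x , t⁻¹~y = complete 2∤n extended-transversal extended-balanced (smaller fewer-uncovered)
      where open Extension 2∤n T-transversal T-balanced x-unc y-unc y≋x⁻¹ t~x t⁻¹~y

corollary1p2 : (n : ℕ) (G : FiniteGroup n) → ¬ (2 ∣ n) → CodePerfect G
corollary1p2 n G 2∤n H H-subgroup _
  with complete G H H-subgroup 2∤n (⁅ε⁆-transversal G H H-subgroup) (⁅ε⁆-balanced G H H-subgroup) (<-wellFounded _)
... | T , T-transversal , covers = transversal⇒perfectCode G H H-subgroup T-transversal covers
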